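{- Every instance of each of the schemata $((\varphi\vee\psi)\ast\chi)\Rightarrow((\varphi\ast\chi)\vee(\psi\ast\chi))$, $(\bot\ast\varphi)\Leftrightarrow\bot$, and $(\mathrm{alloc}(x)\ast\top)\Rightarrow\mathrm{alloc}(x)$ (for arbitrary formulae $\varphi,\psi,\chi$ and program variable $x$) is derivable in $\mathsf{C}(\ast,\mathrel{ -\!\!\ast})$.
   Context: Syntax of $\mathrm{SL}(\ast,\mathrel{ -\!\!\ast})$: fix a countably infinite set $\mathrm{PVAR}$ of program variables. Formulae: $\varphi ::= x = y \mid x \hookrightarrow y \mid \mathrm{emp} \mid \neg\varphi \mid \varphi\wedge\varphi \mid \varphi \ast \varphi \mid \varphi \mathrel{ -\!\!\ast} \varphi$ ($x,y\in\mathrm{PVAR}$); $\vee,\Rightarrow,\Leftrightarrow$ usual abbreviations. Abbreviations: $\bot := \neg(x=x)$, $\top:=\neg\bot$; $\varphi \mathrel{ -\!\!\circledast} \psi := \neg(\varphi\mathrel{ -\!\!\ast}\neg\psi)$; $\mathrm{alloc}(x) := (x\hookrightarrow x)\mathrel{ -\!\!\ast}\bot$; $\mathrm{size}\ge 0 := \top$, $\mathrm{size}\ge 1 := \neg\mathrm{emp}$, $\mathrm{size}\ge\beta := \neg\mathrm{emp}\ast\mathrm{size}\ge\beta-1$ for $\beta\ge2$; $\mathrm{size}=\beta := \mathrm{size}\ge\beta\wedge\neg\,\mathrm{size}\ge\beta+1$; $a\dot- b=\max(0,a-b)$. The system $\mathsf{C}(\ast,\mathrel{ -\!\!\ast})$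 (derivability is the least set containing all instances of the axiom schemata, metavariables ranging over formulae, variables, naturals and finite sets $X\subseteq\mathrm{PVAR}$, and closed under the rules) contains all axiom schemata of classical propositional calculus and modus ponens, together with: (1) $x=x$; (2) $\varphi\wedge x=y\Rightarrow\varphi'$, where $\varphi'$ is obtained from $\varphi$ by replacing every occurrence of $y$ with $x$; (3) $x\hookrightarrow y\Rightarrow\mathrm{alloc}(x)$; (4) $(x\hookrightarrow y\wedge x\hookrightarrow z)\Rightarrow y=z$; (5) $(\varphi\ast\psi)\Leftrightarrow(\psi\ast\varphi)$; (6) $((\varphi\ast\psi)\ast\chi)\Leftrightarrow(\varphi\ast(\psi\ast\chi))$; (7) $\varphi\Leftrightarrow(\varphi\ast\mathrm{emp})$; (8) $(\mathrm{alloc}(x)\ast\mathrm{alloc}(x))\Leftrightarrow\bot$; (9) $(\xi\ast\top)\Rightarrow\xi$ for $\xi\in\{\neg\mathrm{emp},\ x=y,\ \neg(x=y),\ x\hookrightarrow y\}$; (10) $(\neg\mathrm{alloc}(x)\ast\neg\mathrm{alloc}(x))\Rightarrow\neg\mathrm{alloc}(x)$; (11) $((\mathrm{alloc}(x)\wedge\neg x\hookrightarrow y)\ast\top)\Rightarrow\neg x\hookrightarrow y$; (12) $\mathrm{alloc}(x)\Rightarrow((\mathrm{alloc}(x)\wedge\mathrm{size}=1)\ast\top)$; (13) $\neg\mathrm{emp}\Rightarrow(\mathrm{size}=1\ast\top)$; (14) $(\neg\,\mathrm{size}\ge\beta_1\ast\neg\,\mathrm{size}\ge\beta_2)\Rightarrow\neg\,\mathrm{size}\ge\beta_1+\beta_2\dot-1$;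 (15) $(\mathrm{alloc}(x)\wedge\mathrm{alloc}(y)\wedge\neg(x=y))\Rightarrow\mathrm{size}\ge2$; (16) $(\mathrm{size}=1\wedge\bigwedge_{x\in X}\neg\mathrm{alloc}(x))\mathrel{ -\!\!\circledast}\top$; (17) $\neg\mathrm{alloc}(x)\Rightarrow((x\hookrightarrow y\wedge\mathrm{size}=1)\mathrel{ -\!\!\circledast}\top)$; (18) $\neg\mathrm{alloc}(x)\Rightarrow((\mathrm{alloc}(x)\wedge\mathrm{size}=1\wedge\bigwedge_{y\in X}\neg x\hookrightarrow y)\mathrel{ -\!\!\circledast}\top)$; and the rules: from $\varphi\Rightarrow\chi$ infer $(\varphi\ast\psi)\Rightarrow(\chi\ast\psi)$; from $(\varphi\ast\psi)\Rightarrow\chi$ infer $\varphi\Rightarrow(\psi\mathrel{ -\!\!\ast}\chi)$; from $\varphi\Rightarrow(\psi\mathrel{ -\!\!\ast}\chi)$ infer $(\varphi\ast\psi)\Rightarrow\chi$. -}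

module Defs where

open import Data.Nat using (ℕ; zero; suc; _+_; _∸_; _≟_)
open import Data.Bool using (Bool; true; false; not; _∧_)
open import Data.List using (List; []; _∷_)
open import Relation.Binary.PropositionalEquality using (_≡_)
open import Relation.Nullary using (does)

PVAR : Set
PVAR = ℕ

infix 40 ¬'_
infixr 30 _∧'_
infixr 26 _∗_
infixr 24 _-∗_ _-⊛_
data Form : Set where
  _≐_   : PVAR → PVAR → Form
  _↪_   : PVAR → PVAR → Form
  emp   : Form
  ¬'_   : Form → Form
  _∧'_  : Form → Form → Form
  _∗_   : Form → Form → Form
  _-∗_  : Form → Form → Form

infixr 28 _∨'_
infixr 15 _⇒_
infix 14 _⇔_
_∨'_ : Form → Form → Form
φ ∨' ψ = ¬' (¬' φ ∧' ¬' ψ)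

_⇒_ : Form → Form → Form
φ ⇒ ψ = ¬' (φ ∧' ¬' ψ)

_⇔_ : Form → Form → Form
φ ⇔ ψ = (φ ⇒ ψ) ∧' (ψ ⇒ φ)

⊥' : Form
⊥' = ¬' (0 ≐ 0)

⊤' : Form
⊤' = ¬' ⊥'

_-⊛_ : Form → Form → Form
φ -⊛ ψ = ¬' (φ -∗ ¬' ψ)

alloc : PVAR → Form
alloc x = (x ↪ x) -∗ ⊥'

size≥ : ℕ → Form
size≥ zero = ⊤'
size≥ (suc zero) = ¬' emp
size≥ (suc (suc β)) = ¬' emp ∗ size≥ (suc β)

size= : ℕ → Form
size= β = size≥ β ∧' ¬' size≥ (suc β)

⋀ : List Form → Form
⋀ [] = ⊤'
⋀ (φ ∷ φs) = φ ∧' ⋀ φs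

mapL : {A : Set} → (A → Form) → List A → List Form
mapL f [] = []
mapL f (a ∷ as) = f a ∷ mapL f as

renV : PVAR → PVAR → PVAR → PVAR
renV y x z = if' does (z ≟ y) then x else z
  where
  if'_then_else_ : Bool → PVAR → PVAR → PVAR
  if' true then a else b = a
  if' false then a else b = b

ren : PVAR → PVAR → Form → Form
ren y x (a ≐ b) = renV y x a ≐ renV y x b
ren y x (a ↪ b) = renV y x a ↪ renV y x b
ren y x emp = emp
ren y x (¬' φ) = ¬' ren y x φ
ren y x (φ ∧' ψ) = ren y x φ ∧' ren y x ψ
ren y x (φ ∗ ψ) = ren y x φ ∗ ren y x ψ
ren y x (φ -∗ ψ) = ren y x φ -∗ ren y x ψ

-- Classical propositional calculus: axioms are all substitution instances of
-- propositional tautologies over the connectives ¬, ∧ (∨, ⇒ being abbreviations).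
data Prop : Set where
  atom : ℕ → Prop
  pneg : Prop → Prop
  pand : Prop → Prop → Prop

evalP : (ℕ → Bool) → Prop → Bool
evalP v (atom n) = v n
evalP v (pneg p) = not (evalP v p)
evalP v (pand p q) = evalP v p ∧ evalP v q

Tautology : Prop → Set
Tautology p = (v : ℕ → Bool) → evalP v p ≡ true

substP : (ℕ → Form) → Prop → Form
substP σ (atom n) = σ n
substP σ (pneg p) = ¬' substP σ p
substP σ (pand p q) = substP σ p ∧' substP σ q

data ⊢_ : Form → Set where
  taut   : (p : Prop) → Tautology p → (σ : ℕ → Form) → ⊢ substP σ p
  mp     : ∀ {φ ψ} → ⊢ φ → ⊢ (φ ⇒ ψ) → ⊢ ψ
  ax1    : ∀ x → ⊢ (x ≐ x)
  ax2    : ∀ φ x y → ⊢ ((φ ∧' (x ≐ y)) ⇒ ren y x φ)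
  ax3    : ∀ x y → ⊢ ((x ↪ y) ⇒ alloc x)
  ax4    : ∀ x y z → ⊢ (((x ↪ y) ∧' (x ↪ z)) ⇒ (y ≐ z))
  ax5    : ∀ φ ψ → ⊢ ((φ ∗ ψ) ⇔ (ψ ∗ φ))
  ax6    : ∀ φ ψ χ → ⊢ (((φ ∗ ψ) ∗ χ) ⇔ (φ ∗ (ψ ∗ χ)))
  ax7    : ∀ φ → ⊢ (φ ⇔ (φ ∗ emp))
  ax8    : ∀ x → ⊢ ((alloc x ∗ alloc x) ⇔ ⊥')
  ax9emp : ⊢ ((¬' emp ∗ ⊤') ⇒ ¬' emp)
  ax9eq  : ∀ x y → ⊢ (((x ≐ y) ∗ ⊤') ⇒ (x ≐ y))
  ax9neq : ∀ x y → ⊢ ((¬' (x ≐ y) ∗ ⊤') ⇒ ¬' (x ≐ y))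
  ax9pt  : ∀ x y → ⊢ (((x ↪ y) ∗ ⊤') ⇒ (x ↪ y))
  ax10   : ∀ x → ⊢ ((¬' alloc x ∗ ¬' alloc x) ⇒ ¬' alloc x)
  ax11   : ∀ x y → ⊢ (((alloc x ∧' ¬' (x ↪ y)) ∗ ⊤') ⇒ ¬' (x ↪ y))
  ax12   : ∀ x → ⊢ (alloc x ⇒ ((alloc x ∧' size= 1) ∗ ⊤'))
  ax13   : ⊢ (¬' emp ⇒ (size= 1 ∗ ⊤'))
  ax14   : ∀ β₁ β₂ → ⊢ ((¬' size≥ β₁ ∗ ¬' size≥ β₂) ⇒ ¬' size≥ (β₁ + β₂ ∸ 1))
  ax15   : ∀ x y → ⊢ ((alloc x ∧' alloc y ∧' ¬' (x ≐ y)) ⇒ size≥ 2)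
  ax16   : (X : List PVAR) → ⊢ ((size= 1 ∧' ⋀ (mapL (λ x → ¬' alloc x) X)) -⊛ ⊤')
  ax17   : ∀ x y → ⊢ (¬' alloc x ⇒ (((x ↪ y) ∧' size= 1) -⊛ ⊤'))
  ax18   : ∀ x (X : List PVAR) →
           ⊢ (¬' alloc x ⇒ ((alloc x ∧' size= 1 ∧' ⋀ (mapL (λ y → ¬' (x ↪ y)) X)) -⊛ ⊤'))
  ∗-intro : ∀ {φ χ} ψ → ⊢ (φ ⇒ χ) → ⊢ ((φ ∗ ψ) ⇒ (χ ∗ ψ))
  curry   : ∀ {φ ψ χ} → ⊢ ((φ ∗ ψ) ⇒ χ) → ⊢ (φ ⇒ (ψ -∗ χ))
  uncurry : ∀ {φ ψ χ} → ⊢ (φ ⇒ (ψ -∗ χ)) → ⊢ ((φ ∗ ψ) ⇒ χ)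

-- Every schema we need is an instance of a
--    tautology in at most three atoms, and such tautologies are checked
--    once and for all by evaluating the eight rows of the truth table
--    ('threeAtomTautology').  From them we derive the usual rules:
--    transitivity of ⇒, the two halves of ⇔, ex falso, case analysis, ...
-- 2. The separation-logic lemmas, at their natural generality:
--    ∗ distributes over ∨ (using the adjunction curry/uncurry), ⊥ annihilates
--    ∗, and a wand into ⊥ is preserved under ∗ with any frame χ, because
--    ((P -∗ ⊥) ∗ χ) ∗ P can be rearranged into ((P -∗ ⊥) ∗ P) ∗ χ.
-- 3. The theorem: alloc x is P -∗ ⊥ with P = x ↪ x, and ⊤ is the frame.
module Submission where

open import Defs
open import Data.Product using (_×_; _,_; proj₁; proj₂)
open import Data.Nat using (ℕ)
open import Data.Bool using (Bool; true; false; _∧_; T)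
open import Data.Bool.Properties using (T-≡; T-∧)
open import Function.Bundles using (Equivalence)
open import Relation.Binary.PropositionalEquality using (_≡_; refl)

a b c : Prop
a = atom 0
b = atom 1
c = atom 2

infixr 15 _⇒ₚ_
infixr 28 _∨ₚ_

_⇒ₚ_ : Prop → Prop → Prop
p ⇒ₚ q = pneg (pand p (pneg q))

_∨ₚ_ : Prop → Prop → Prop
p ∨ₚ q = pneg (pand (pneg p) (pneg q))

valuation₃ : Bool → Bool → Bool → ℕ → Bool
valuation₃ x y z 0 = x
valuation₃ x y z 1 = y
valuation₃ x y z _ = z

subst₃ : Form → Form → Form → ℕ → Form
subst₃ A B C 0 = A
subst₃ A B C 1 = B
subst₃ A B C _ = C

every : (Bool → Bool) → Bool
every f = f true ∧ f false

every-sound : (f : Bool → Bool) → T (every f) → (x : Bool) → T (f x)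
every-sound f ok true  = proj₁ (Equivalence.to (T-∧ {f true} {f false}) ok)
every-sound f ok false = proj₂ (Equivalence.to (T-∧ {f true} {f false}) ok)

allRows : (Bool → Bool → Bool → Bool) → Bool
allRows g = every (λ x → every (λ y → every (λ z → g x y z)))

allRows-sound : (g : Bool → Bool → Bool → Bool) → T (allRows g) →
                (x y z : Bool) → g x y z ≡ true
allRows-sound g ok x y z = Equivalence.to T-≡
  (every-sound (g x y) (every-sound (λ y → every (g x y))
    (every-sound (λ x → every (λ y → every (g x y))) ok x) y) z)

-- A Prop whose value depends only on atoms a, b, c (witnessed by 'depends',
-- which is 'λ _ → refl' for any concrete such p) and whose truth table is
-- all true is a tautology; each of its instances is then an axiom.
threeAtomTautology : (p : Prop) →
  ((v : ℕ → Bool) → evalP v p ≡ evalP (valuation₃ (v 0) (v 1) (v 2)) p) →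
  T (allRows (λ x y z → evalP (valuation₃ x y z) p)) →
  (A B C : Form) → ⊢ substP (subst₃ A B C) p
threeAtomTautology p depends ok A B C = taut p tautology (subst₃ A B C)
  where
  tautology : Tautology p
  tautology v rewrite depends v = allRows-sound (λ x y z → evalP (valuation₃ x y z) p) ok (v 0) (v 1) (v 2)

identity : ∀ A → ⊢ (A ⇒ A)
identity A = threeAtomTautology (a ⇒ₚ a) (λ _ → refl) _ A A A

trans⇒ : ∀ {A B C} → ⊢ (A ⇒ B) → ⊢ (B ⇒ C) → ⊢ (A ⇒ C)
trans⇒ {A} {B} {C} A⇒B B⇒C = mp B⇒C (mp A⇒B
  (threeAtomTautology ((a ⇒ₚ b) ⇒ₚ (b ⇒ₚ c) ⇒ₚ (a ⇒ₚ c)) (λ _ → refl) _ A B C))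

⇔-intro : ∀ {A B} → ⊢ (A ⇒ B) → ⊢ (B ⇒ A) → ⊢ (A ⇔ B)
⇔-intro {A} {B} A⇒B B⇒A = mp B⇒A (mp A⇒B
  (threeAtomTautology (a ⇒ₚ b ⇒ₚ pand a b) (λ _ → refl) _ (A ⇒ B) (B ⇒ A) ⊥'))

⇔-fwd : ∀ {A B} → ⊢ (A ⇔ B) → ⊢ (A ⇒ B)
⇔-fwd {A} {B} A⇔B =
  mp A⇔B (threeAtomTautology (pand a b ⇒ₚ a) (λ _ → refl) _ (A ⇒ B) (B ⇒ A) ⊥')

⇔-bwd : ∀ {A B} → ⊢ (A ⇔ B) → ⊢ (B ⇒ A)
⇔-bwd {A} {B} A⇔B =
  mp A⇔B (threeAtomTautology (pand a b ⇒ₚ b) (λ _ → refl) _ (A ⇒ B) (B ⇒ A) ⊥')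

-- Ex falso: ⊥' is ¬(0 = 0), and 0 = 0 is axiom 1.
ex-falso : ∀ B → ⊢ (⊥' ⇒ B)
ex-falso B = mp (ax1 0) (threeAtomTautology (a ⇒ₚ pneg a ⇒ₚ b) (λ _ → refl) _ (0 ≐ 0) B B)

∨-introˡ : ∀ A B → ⊢ (A ⇒ (A ∨' B))
∨-introˡ A B = threeAtomTautology (a ⇒ₚ a ∨ₚ b) (λ _ → refl) _ A B B

∨-introʳ : ∀ A B → ⊢ (B ⇒ (A ∨' B))
∨-introʳ A B = threeAtomTautology (b ⇒ₚ a ∨ₚ b) (λ _ → refl) _ A B B

∨-elim : ∀ {A B C} → ⊢ (A ⇒ C) → ⊢ (B ⇒ C) → ⊢ ((A ∨' B) ⇒ C)
∨-elim {A} {B} {C} A⇒C B⇒C = mp B⇒C (mp A⇒C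
  (threeAtomTautology ((a ⇒ₚ c) ⇒ₚ (b ⇒ₚ c) ⇒ₚ (a ∨ₚ b ⇒ₚ c)) (λ _ → refl) _ A B C))

∗-monoʳ : ∀ {A B} C → ⊢ (A ⇒ B) → ⊢ ((C ∗ A) ⇒ (C ∗ B))
∗-monoʳ {A} {B} C A⇒B =
  trans⇒ (⇔-fwd (ax5 C A)) (trans⇒ (∗-intro C A⇒B) (⇔-fwd (ax5 B C)))

∗-exchange : ∀ A B C → ⊢ (((A ∗ B) ∗ C) ⇒ ((A ∗ C) ∗ B))
∗-exchange A B C =
  trans⇒ (⇔-fwd (ax6 A B C)) (trans⇒ (∗-monoʳ A (⇔-fwd (ax5 B C))) (⇔-bwd (ax6 A C B)))

-- ∗ distributes over ∨: both disjuncts land in the target after currying χ.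
∗-distrib-∨ : ∀ φ ψ χ → ⊢ (((φ ∨' ψ) ∗ χ) ⇒ ((φ ∗ χ) ∨' (ψ ∗ χ)))
∗-distrib-∨ φ ψ χ =
  uncurry (∨-elim (curry (∨-introˡ (φ ∗ χ) (ψ ∗ χ))) (curry (∨-introʳ (φ ∗ χ) (ψ ∗ χ))))

-- ⊥ annihilates ∗: ⊥ ⇒ (φ -∗ ⊥) by ex falso, then uncurry.
⊥-∗ : ∀ φ → ⊢ ((⊥' ∗ φ) ⇔ ⊥')
⊥-∗ φ = ⇔-intro (uncurry (ex-falso (φ -∗ ⊥'))) (ex-falso (⊥' ∗ φ))

-- A wand into ⊥ survives framing: ((P -∗ ⊥) ∗ χ) ∗ P rearranges to
-- ((P -∗ ⊥) ∗ P) ∗ χ, whose left factor implies ⊥, and ⊥ ∗ χ is ⊥.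
wand⊥-frame : ∀ P χ → ⊢ (((P -∗ ⊥') ∗ χ) ⇒ (P -∗ ⊥'))
wand⊥-frame P χ = curry (trans⇒ (∗-exchange (P -∗ ⊥') χ P)
                        (trans⇒ (∗-intro χ apply) (⇔-fwd (⊥-∗ χ))))
  where
  apply : ⊢ (((P -∗ ⊥') ∗ P) ⇒ ⊥')
  apply = uncurry (identity (P -∗ ⊥'))

lemma6p1 : (φ ψ χ : Form) (x : PVAR) →
    (⊢ (((φ ∨' ψ) ∗ χ) ⇒ ((φ ∗ χ) ∨' (ψ ∗ χ))))
    × (⊢ ((⊥' ∗ φ) ⇔ ⊥'))
    × (⊢ ((alloc x ∗ ⊤') ⇒ alloc x))
lemma6p1 φ ψ χ x = ∗-distrib-∨ φ ψ χ , ⊥-∗ φ , wand⊥-frame (x ↪ x) ⊤'
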